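{- Let $n,r$ be nonnegative integers with $2\leq r\leq\lceil n/2\rceil$. Then it is possible for the pulse $K(n,r)$ to terminate in $\mathrm{Az}(n)$: there is a finite sequence of firing moves from $K(n,r)$ ending at the stable configuration $\mathrm{Az}(n)$.
   Context: The grid complex is the tiling of the plane by unit squares ("faces"); two faces are adjacent if they share an edge, and $\mathrm{dist}(f,g)$ is the Manhattan distance between faces. A configuration $K$ assigns an integer weight $K_f$ to each face $f$, with finitely many nonzero weights; there is a marked face $f_0$ with $K_{f_0}=n$. Firing moves: (i) if $f,g$ are adjacent faces, both different from $f_0$, with $K_f\geq K_g+2$, one may fire $f$ towards $g$, decreasing $K_f$ by $1$ and increasing $K_g$ by $1$; (ii) if $g$ is adjacent to $f_0$ and $K_g<n$, one may fire from $f_0$ to $g$, increasing $K_g$ by $1$; (iii) if $g$ is adjacent to $f_0$ and $K_g>n$, one may fire from $g$ to $f_0$, decreasing $K_g$ by $1$; the weight of $f_0$ never changes. A configuration is stable if no firing move is possible. The pulse $K(n,r)$ has $K(n,r)_f=n$ if $\mathrm{dist}(f_0,f)\leq r$ and $0$ otherwise. The Aztec diamond $\mathrm{Az}(n)$ has $\mathrm{Az}(n)_{f_0}=n$ and $\mathrm{Az}(n)_f=\max\{n-\mathrm{dist}(f_0,f)+1,0\}$ for $f\neq f_0$. -}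

module Defs where

open import Data.Nat as ℕ using (ℕ)
open import Data.Integer as ℤ using (ℤ; +_; _-_; ∣_∣; _≤_; _<_)
open import Data.Integer.Properties as ℤP using ()
open import Data.Product using (_×_; _,_; Σ; ∃; ∃-syntax)
open import Data.Product.Properties using (≡-dec)
open import Relation.Binary.PropositionalEquality using (_≡_; _≢_)
open import Relation.Nullary using (¬_; Dec; yes; no)
open import Relation.Binary.Construct.Closure.ReflexiveTransitive using (Star)

-- Faces of the grid complex: unit squares indexed by integer coordinates.
Face : Set
Face = ℤ × ℤ

f₀ : Face
f₀ = (+ 0 , + 0)

_≟F_ : (f g : Face) → Dec (f ≡ g)
_≟F_ = ≡-dec ℤ._≟_ ℤ._≟_

dist : Face → Face → ℕ
dist (x₁ , y₁) (x₂ , y₂) = ∣ x₁ - x₂ ∣ ℕ.+ ∣ y₁ - y₂ ∣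

Adjacent : Face → Face → Set
Adjacent f g = dist f g ≡ 1

-- A configuration assigns an integer weight to each face.
-- (All configurations reachable from the pulse have finite support, since
-- the moves change only finitely many weights.)
Config : Set
Config = Face → ℤ

-- Firing moves with marked weight n (K f₀ = n is never changed).
-- K' is the result of the move, described pointwise.
data Step (n : ℕ) (K K' : Config) : Set where
  fire : (f g : Face) → f ≢ f₀ → g ≢ f₀ → Adjacent f g →
         K g ℤ.+ + 2 ≤ K f →
         K' f ≡ K f - + 1 →
         K' g ≡ K g ℤ.+ + 1 →
         (∀ h → h ≢ f → h ≢ g → K' h ≡ K h) →
         Step n K K'
  fromMarked : (g : Face) → Adjacent g f₀ → K g < + n →
         K' g ≡ K g ℤ.+ + 1 →
         (∀ h → h ≢ g → K' h ≡ K h) →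
         Step n K K'
  toMarked : (g : Face) → Adjacent g f₀ → + n < K g →
         K' g ≡ K g - + 1 →
         (∀ h → h ≢ g → K' h ≡ K h) →
         Step n K K'

Reaches : ℕ → Config → Config → Set
Reaches n = Star (Step n)

Stable : ℕ → Config → Set
Stable n K = ∀ K' → ¬ Step n K K'

pulse : ℕ → ℕ → Config
pulse n r f with dist f₀ f ℕ.≤? r
... | yes _ = + n
... | no _  = + 0

Az : ℕ → Config
Az n f with f ≟F f₀
... | yes _ = + n
... | no _  = + (ℕ.suc n ℕ.∸ dist f₀ f)

-- Away from f₀ the plane is the union of four quarter-turned copies of {(a + 1 , b)}, and row b of
-- each copy is reached from f₀ by a shortest path that first runs along row 0 of the next copy.
-- Rows are settled in increasing order, copy by copy.  Along such a path the moves are chip-firing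
-- on a line fed by the marked face, and the target is the Aztec profile j ↦ n + 1 - j.  The
-- unsettled tail of the path is raised cell by cell; each missing unit is relayed, through cells
-- already on the profile, from the highest cell holding a surplus, or from f₀ when there is none.
-- Because r ≤ ⌈n/2⌉, the pulse puts at most r n ≤ n (n + 1) / 2 chips on the path, so in the end
-- no surplus is left and the path carries exactly the profile.  Az(n) is stable because
-- n + 1 - dist f₀ changes by at most one between adjacent faces.

module Submission where

open import Defs
open import Algebra.Properties.CommutativeSemigroup using (interchange)
open import Data.Empty using (⊥-elim)
open import Data.Unit using (⊤; tt)
open import Data.Integer as ℤ using (ℤ; +_; -[1+_]; ∣_∣; _⊖_; +≤+; +<+)
import Data.Integer.Properties as ℤₚ
open import Data.Nat
  using (ℕ; zero; suc; _+_; _*_; _∸_; _≤_; _<_; _≤?_; _<?_; z≤n; s≤s; z<s; >-nonZero; pred; ⌈_/2⌉; ⌊_/2⌋)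
open import Data.Nat.Properties
open import Data.Product using (_×_; _,_; proj₁; proj₂; map₂; ∃; ∃-syntax)
open import Data.Sum using (_⊎_; inj₁; inj₂)
open import Function using (_∘_)
open import Relation.Nullary using (¬_; Dec; yes; no)
open import Relation.Binary.Definitions using (tri<; tri≈; tri>)
open import Relation.Binary.PropositionalEquality
open import Relation.Binary.Construct.Closure.ReflexiveTransitive using (Star; ε; _◅_; _◅◅_; gmap)

-- The grid and the Aztec diamond

∣i-i∣≡0 : ∀ i → ∣ i ℤ.- i ∣ ≡ 0
∣i-i∣≡0 i = cong ∣_∣ (ℤₚ.+-inverseʳ i)

∣i-k∣≤∣i-j∣+∣j-k∣ : ∀ i j k → ∣ i ℤ.- k ∣ ≤ ∣ i ℤ.- j ∣ + ∣ j ℤ.- k ∣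
∣i-k∣≤∣i-j∣+∣j-k∣ i j k =
  subst (λ z → ∣ z ∣ ≤ ∣ i ℤ.- j ∣ + ∣ j ℤ.- k ∣) (ℤₚ.+-minus-telescope i j k)
    (ℤₚ.∣i+j∣≤∣i∣+∣j∣ (i ℤ.- j) (j ℤ.- k))

dist-self : ∀ f → dist f f ≡ 0
dist-self (x , y) = cong₂ _+_ (∣i-i∣≡0 x) (∣i-i∣≡0 y)

dist-comm : ∀ f g → dist f g ≡ dist g f
dist-comm (x , y) (x′ , y′) = cong₂ _+_ (ℤₚ.∣i-j∣≡∣j-i∣ x x′) (ℤₚ.∣i-j∣≡∣j-i∣ y y′)

dist-triangle : ∀ e f g → dist e g ≤ dist e f + dist f g
dist-triangle (x , y) (x′ , y′) (x″ , y″) = ≤-trans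
  (+-mono-≤ (∣i-k∣≤∣i-j∣+∣j-k∣ x x′ x″) (∣i-k∣≤∣i-j∣+∣j-k∣ y y′ y″))
  (≤-reflexive (interchange +-commutativeSemigroup
    (∣ x ℤ.- x′ ∣) (∣ x′ ℤ.- x″ ∣) (∣ y ℤ.- y′ ∣) (∣ y′ ℤ.- y″ ∣)))

adjacent⇒≢ : ∀ {f g} → Adjacent f g → f ≢ g
adjacent⇒≢ {f} f~g refl = 0≢1+n (trans (sym (dist-self f)) f~g)

Az-f₀ : ∀ n → Az n f₀ ≡ + n
Az-f₀ n with f₀ ≟F f₀
... | yes _ = refl
... | no f₀≢f₀ = ⊥-elim (f₀≢f₀ refl)

Az-≢f₀ : ∀ n {h} → h ≢ f₀ → Az n h ≡ + (suc n ∸ dist f₀ h)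
Az-≢f₀ n {h} h≢f₀ with h ≟F f₀
... | yes h≡f₀ = ⊥-elim (h≢f₀ h≡f₀)
... | no _ = refl

Az-adjacent-f₀ : ∀ n {g} → Adjacent g f₀ → Az n g ≡ + n
Az-adjacent-f₀ n {g} g~f₀ =
  trans (Az-≢f₀ n (adjacent⇒≢ g~f₀)) (cong (λ d → + (suc n ∸ d)) (trans (dist-comm f₀ g) g~f₀))

pulse-≤ : ∀ n r {h} → dist f₀ h ≤ r → pulse n r h ≡ + n
pulse-≤ n r {h} h≤r with dist f₀ h ≤? r
... | yes _ = refl
... | no h≰r = ⊥-elim (h≰r h≤r)

pulse-> : ∀ n r {h} → r < dist f₀ h → pulse n r h ≡ + 0
pulse-> n r {h} r<h with dist f₀ h ≤? r
... | yes h≤r = ⊥-elim (<⇒≱ r<h h≤r)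
... | no _ = refl

pulse-nonneg : ∀ n r h → pulse n r h ≡ + ∣ pulse n r h ∣
pulse-nonneg n r h with dist f₀ h ≤? r
... | yes _ = refl
... | no _ = refl

m∸n≤1+m∸o : ∀ m {n o} → o ≤ suc n → m ∸ n ≤ suc (m ∸ o)
m∸n≤1+m∸o zero {n} {o} _ = subst (_≤ suc (0 ∸ o)) (sym (0∸n≡0 n)) z≤n
m∸n≤1+m∸o (suc m) {n} {zero} _ = ≤-trans (m∸n≤m (suc m) n) (n≤1+n (suc m))
m∸n≤1+m∸o (suc m) {zero} {suc zero} _ = ≤-refl
m∸n≤1+m∸o (suc m) {zero} {suc (suc o)} (s≤s ())
m∸n≤1+m∸o (suc m) {suc n} {suc o} (s≤s o≤1+n) = m∸n≤1+m∸o m o≤1+n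

Az-stable : ∀ n → Stable n (Az n)
Az-stable n _ (fire f g f≢f₀ g≢f₀ f~g g+2≤f _ _ _) = <⇒≱ steep flat
  where
  steep : suc (suc n ∸ dist f₀ g) < suc n ∸ dist f₀ f
  steep = subst (_≤ suc n ∸ dist f₀ f) (+-comm (suc n ∸ dist f₀ g) 2)
    (ℤₚ.drop‿+≤+ (subst₂ ℤ._≤_ (cong (ℤ._+ + 2) (Az-≢f₀ n g≢f₀)) (Az-≢f₀ n f≢f₀) g+2≤f))
  flat : suc n ∸ dist f₀ f ≤ suc (suc n ∸ dist f₀ g)
  flat = m∸n≤1+m∸o (suc n) (subst (dist f₀ g ≤_)
    (trans (cong (λ d → dist f₀ f + d) f~g) (+-comm _ 1)) (dist-triangle f₀ f g))
Az-stable n _ (fromMarked g g~f₀ g<n _ _) = ℤₚ.<-irrefl (Az-adjacent-f₀ n g~f₀) g<n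
Az-stable n _ (toMarked g g~f₀ n<g _ _) = ℤₚ.<-irrefl (sym (Az-adjacent-f₀ n g~f₀)) n<g

Step-respˡ : ∀ {n K L K′} → K ≗ L → Step n L K′ → Step n K K′
Step-respˡ K≗L (fire f g f≢f₀ g≢f₀ f~g g+2≤f eq-f eq-g rest) = fire f g f≢f₀ g≢f₀ f~g
  (subst₂ ℤ._≤_ (cong (ℤ._+ + 2) (sym (K≗L g))) (sym (K≗L f)) g+2≤f)
  (trans eq-f (cong (ℤ._- + 1) (sym (K≗L f))))
  (trans eq-g (cong (ℤ._+ + 1) (sym (K≗L g))))
  (λ h h≢f h≢g → trans (rest h h≢f h≢g) (sym (K≗L h)))
Step-respˡ K≗L (fromMarked g g~f₀ g<n eq-g rest) = fromMarked g g~f₀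
  (subst (ℤ._< _) (sym (K≗L g)) g<n)
  (trans eq-g (cong (ℤ._+ + 1) (sym (K≗L g))))
  (λ h h≢g → trans (rest h h≢g) (sym (K≗L h)))
Step-respˡ K≗L (toMarked g g~f₀ n<g eq-g rest) = toMarked g g~f₀
  (subst (_ ℤ.<_) (sym (K≗L g)) n<g)
  (trans eq-g (cong (ℤ._- + 1) (sym (K≗L g))))
  (λ h h≢g → trans (rest h h≢g) (sym (K≗L h)))

Reaches-respˡ : ∀ {n K L L′} → K ≗ L → Reaches n L L′ → ∃[ K′ ] (Reaches n K K′ × K′ ≗ L′)
Reaches-respˡ {K = K} K≗L ε = K , ε , K≗L
Reaches-respˡ {L′ = L′} K≗L (s ◅ ss) = L′ , Step-respˡ K≗L s ◅ ss , λ _ → refl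

-- Sums over intervals

∑ : (ℕ → ℕ) → ℕ → ℕ → ℕ
∑ f a zero = 0
∑ f a (suc l) = f a + ∑ f (suc a) l

Within : ℕ → ℕ → ℕ → Set
Within a l j = a ≤ j × j < a + l

within-head : ∀ a l → Within a (suc l) a
within-head a l = ≤-refl , m<m+n a (s≤s z≤n)

within-tail : ∀ {a l j} → Within (suc a) l j → Within a (suc l) j
within-tail {a} {l} {j} (a<j , j<) = <⇒≤ a<j , subst (j <_) (sym (+-suc a l)) j<

within-step : ∀ {a l j} → a ≢ j → Within a (suc l) j → Within (suc a) l j
within-step {a} {l} {j} a≢j (a≤j , j<) = ≤∧≢⇒< a≤j a≢j , subst (j <_) (+-suc a l) j<

within-empty : ∀ {a j} → ¬ Within a 0 j
within-empty {a} {j} (a≤j , j<a+0) = <⇒≱ (subst (j <_) (+-identityʳ a) j<a+0) a≤j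

∑-cong : ∀ {f g} a l → (∀ j → Within a l j → f j ≡ g j) → ∑ f a l ≡ ∑ g a l
∑-cong a zero _ = refl
∑-cong a (suc l) f≡g =
  cong₂ _+_ (f≡g a (within-head a l)) (∑-cong (suc a) l (λ j → f≡g j ∘ within-tail))

∑-mono-≤ : ∀ {f g} a l → (∀ j → Within a l j → f j ≤ g j) → ∑ f a l ≤ ∑ g a l
∑-mono-≤ a zero _ = z≤n
∑-mono-≤ a (suc l) f≤g =
  +-mono-≤ (f≤g a (within-head a l)) (∑-mono-≤ (suc a) l (λ j → f≤g j ∘ within-tail))

∑-mono-< : ∀ {f g} a l {x} → (∀ j → Within a l j → f j ≤ g j) → Within a l x → f x < g x →
  ∑ f a l < ∑ g a l
∑-mono-< a zero _ x∈ _ = ⊥-elim (within-empty x∈)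
∑-mono-< a (suc l) {x} f≤g x∈ fx<gx with a ≟ x
... | yes refl = +-mono-<-≤ fx<gx (∑-mono-≤ (suc a) l (λ j → f≤g j ∘ within-tail))
... | no a≢x = +-mono-≤-< (f≤g a (within-head a l))
  (∑-mono-< (suc a) l (λ j → f≤g j ∘ within-tail) (within-step a≢x x∈) fx<gx)

∑-≤-antisym : ∀ {f g} a l → (∀ j → Within a l j → g j ≤ f j) → ∑ f a l ≤ ∑ g a l →
  ∀ j → Within a l j → f j ≡ g j
∑-≤-antisym a l g≤f ∑f≤∑g j j∈ with m≤n⇒m<n∨m≡n (g≤f j j∈)
... | inj₁ gj<fj = ⊥-elim (<⇒≱ (∑-mono-< a l g≤f j∈ gj<fj) ∑f≤∑g)
... | inj₂ gj≡fj = sym gj≡fj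

∑-const : ∀ c a l → ∑ (λ _ → c) a l ≡ l * c
∑-const c a zero = refl
∑-const c a (suc l) = cong (_+_ c) (∑-const c (suc a) l)

∑-shift : ∀ f a l → ∑ f (suc a) l ≡ ∑ (f ∘ suc) a l
∑-shift f a zero = refl
∑-shift f a (suc l) = cong (_+_ (f (suc a))) (∑-shift f (suc a) l)

∑-split : ∀ f a l m → ∑ f a (l + m) ≡ ∑ f a l + ∑ f (a + l) m
∑-split f a zero m = cong (λ b → ∑ f b m) (sym (+-identityʳ a))
∑-split f a (suc l) m = begin
  f a + ∑ f (suc a) (l + m)                 ≡⟨ cong (_+_ (f a)) (∑-split f (suc a) l m) ⟩
  f a + (∑ f (suc a) l + ∑ f (suc a + l) m) ≡⟨ sym (+-assoc (f a) _ _) ⟩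
  f a + ∑ f (suc a) l + ∑ f (suc a + l) m   ≡⟨ cong (λ b → f a + ∑ f (suc a) l + ∑ f b m) (sym (+-suc a l)) ⟩
  f a + ∑ f (suc a) l + ∑ f (a + suc l) m   ∎
  where open ≡-Reasoning

∑-point : ∀ {f g} a l {x} → (∀ j → Within a l j → j ≢ x → f j ≡ g j) → Within a l x →
  ∑ g a l + f x ≡ ∑ f a l + g x
∑-point a zero _ x∈ = ⊥-elim (within-empty x∈)
∑-point {f} {g} a (suc l) {x} f≡g x∈ with a ≟ x
... | yes refl = begin
  g a + ∑ g (suc a) l + f a   ≡⟨ cong (λ s → g a + s + f a) (sym tail-agrees) ⟩
  g a + ∑ f (suc a) l + f a   ≡⟨ +-comm (g a + _) (f a) ⟩
  f a + (g a + ∑ f (suc a) l) ≡⟨ cong (_+_ (f a)) (+-comm (g a) _) ⟩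
  f a + (∑ f (suc a) l + g a) ≡⟨ sym (+-assoc (f a) _ (g a)) ⟩
  f a + ∑ f (suc a) l + g a   ∎
  where
  open ≡-Reasoning
  tail-agrees : ∑ f (suc a) l ≡ ∑ g (suc a) l
  tail-agrees = ∑-cong (suc a) l λ j j∈ → f≡g j (within-tail j∈) (>⇒≢ (proj₁ j∈))
... | no a≢x = begin
  g a + ∑ g (suc a) l + f x   ≡⟨ +-assoc (g a) _ (f x) ⟩
  g a + (∑ g (suc a) l + f x) ≡⟨ cong₂ _+_ (sym (f≡g a (within-head a l) a≢x))
                                    (∑-point (suc a) l (λ j → f≡g j ∘ within-tail) (within-step a≢x x∈)) ⟩
  f a + (∑ f (suc a) l + g x) ≡⟨ sym (+-assoc (f a) _ (g x)) ⟩
  f a + ∑ f (suc a) l + g x   ∎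
  where open ≡-Reasoning

-- Chip-firing on a path fed by the marked face

Profile : Set
Profile = ℕ → ℕ

_[_]≔_ : Profile → ℕ → ℕ → Profile
(w [ i ]≔ x) j with j ≟ i
... | yes _ = x
... | no _ = w j

[]≔-same : ∀ w i x → (w [ i ]≔ x) i ≡ x
[]≔-same w i x with i ≟ i
... | yes _ = refl
... | no i≢i = ⊥-elim (i≢i refl)

[]≔-other : ∀ w {i j} x → j ≢ i → (w [ i ]≔ x) j ≡ w j
[]≔-other w {i} {j} x j≢i with j ≟ i
... | yes j≡i = ⊥-elim (j≢i j≡i)
... | no _ = refl

-- Entry 0 of a profile stands for the marked face: an inexhaustible source whose entry is never read.
Loses : ℕ → Profile → Profile → Set
Loses zero w w′ = ⊤
Loses (suc p) w w′ = suc (w′ (suc p)) ≡ w (suc p)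

record UnitMove (p q : ℕ) (w w′ : Profile) : Set where
  field
    loses : Loses p w w′
    gains : w′ q ≡ suc (w q)
    rest  : ∀ j → j ≢ p → j ≢ q → w′ j ≡ w j

unitMove : ∀ p {q} w → p ≢ q → (0 < p → 0 < w p) → ∃ (UnitMove p q w)
unitMove zero {q} w _ _ = w [ q ]≔ suc (w q) , record
  { loses = tt
  ; gains = []≔-same w q _
  ; rest  = λ j _ j≢q → []≔-other w _ j≢q }
unitMove (suc p) {q} w p≢q stocked = w′ , record
  { loses = trans (cong suc (trans ([]≔-other _ _ p≢q) ([]≔-same w (suc p) _)))
                  (suc-pred (w (suc p)) ⦃ >-nonZero (stocked z<s) ⦄)
  ; gains = []≔-same _ q _
  ; rest  = λ j j≢p j≢q → trans ([]≔-other _ _ j≢q) ([]≔-other w _ j≢p) }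
  where
  w′ = (w [ suc p ]≔ pred (w (suc p))) [ q ]≔ suc (w q)

Pushable : ℕ → Profile → ℕ → Set
Pushable n w zero = w 1 < n
Pushable n w (suc p) = 2 + w (suc (suc p)) ≤ w (suc p)

data PathStep (n : ℕ) (w w′ : Profile) : Set where
  push : ∀ p → Pushable n w p → UnitMove p (suc p) w w′ → PathStep n w w′

loses-resp : ∀ p {w v w′} → v p ≡ w p → Loses p w w′ → Loses p v w′
loses-resp zero _ _ = tt
loses-resp (suc p) vp≡wp l = trans l (sym vp≡wp)

loses-suc : ∀ {p w w′} → 0 < p → Loses p w w′ → suc (w′ p) ≡ w p
loses-suc {suc p} _ l = l

unitMove-factor : ∀ {p q w w₁ w′} → p < q →
  UnitMove q (suc q) w w₁ → UnitMove p (suc q) w w′ → UnitMove p q w₁ w′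
unitMove-factor {p} {q} {w} {w₁} {w′} p<q first whole = record
  { loses = loses-resp p (W₁.rest p (<⇒≢ p<q) (<⇒≢ (m<n⇒m<1+n p<q))) W.loses
  ; gains = trans (W.rest q (>⇒≢ p<q) (<⇒≢ (n<1+n q))) (sym (loses-suc (≤-<-trans z≤n p<q) W₁.loses))
  ; rest  = rest′ }
  where
  module W₁ = UnitMove first
  module W = UnitMove whole
  rest′ : ∀ j → j ≢ p → j ≢ q → w′ j ≡ w₁ j
  rest′ j j≢p j≢q with j ≟ suc q
  ... | yes refl = trans W.gains (sym W₁.gains)
  ... | no j≢1+q = trans (W.rest j j≢p j≢1+q) (sym (W₁.rest j j≢q j≢1+q))

extend-≡ : ∀ {f g : ℕ → ℕ} {b q} → (∀ j → b < j → j < q → f j ≡ g j) → f q ≡ g q →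
  ∀ j → b < j → j < suc q → f j ≡ g j
extend-≡ equal fq≡gq j b<j j<1+q with m<1+n⇒m<n∨m≡n j<1+q
... | inj₁ j<q = equal j b<j j<q
... | inj₂ refl = fq≡gq

all-≡-or-last-< : ∀ {f g : ℕ → ℕ} a q → (∀ j → a < j → j < q → f j ≤ g j) →
  (∀ j → a < j → j < q → f j ≡ g j) ⊎
  ∃[ p ] (a < p × p < q × f p < g p × ∀ j → p < j → j < q → f j ≡ g j)
all-≡-or-last-< a zero _ = inj₁ λ _ _ ()
all-≡-or-last-< a (suc q) f≤g with a <? q
... | no a≮q = inj₁ λ j a<j j<1+q → ⊥-elim (a≮q (<-≤-trans a<j (≤-pred j<1+q)))
... | yes a<q with m≤n⇒m<n∨m≡n (f≤g q a<q (n<1+n q))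
...   | inj₁ fq<gq =
  inj₂ (q , a<q , n<1+n q , fq<gq , λ j q<j j<1+q → ⊥-elim (<⇒≱ q<j (≤-pred j<1+q)))
...   | inj₂ fq≡gq with all-≡-or-last-< a q (λ j a<j j<q → f≤g j a<j (m<n⇒m<1+n j<q))
...     | inj₁ equal = inj₁ (extend-≡ equal fq≡gq)
...     | inj₂ (p , a<p , p<q , fp<gp , equal) =
  inj₂ (p , a<p , m<n⇒m<1+n p<q , fp<gp , extend-≡ equal fq≡gq)

∑-unitMove-source : ∀ {q w w′} a l → 0 < a → Within a l q → UnitMove 0 q w w′ →
  ∑ w′ a l ≡ suc (∑ w a l)
∑-unitMove-source {q} {w} {w′} a l 0<a q∈ move = +-cancelʳ-≡ (w q) _ _ (begin
  ∑ w′ a l + w q      ≡⟨ ∑-point a l (λ j j∈ j≢q → sym (M.rest j (>⇒≢ (<-≤-trans 0<a (proj₁ j∈))) j≢q)) q∈ ⟩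
  ∑ w a l + w′ q      ≡⟨ cong (_+_ (∑ w a l)) M.gains ⟩
  ∑ w a l + suc (w q) ≡⟨ +-suc (∑ w a l) (w q) ⟩
  suc (∑ w a l) + w q ∎)
  where
  open ≡-Reasoning
  module M = UnitMove move

∑-unitMove-inner : ∀ {p q w w′} a l → 0 < p → p ≢ q → Within a l p → Within a l q →
  UnitMove p q w w′ → ∑ w′ a l ≡ ∑ w a l
∑-unitMove-inner {p} {q} {w} {w′} a l 0<p p≢q p∈ q∈ move = trans (sym u-below-w′) u-below-w
  where
  open ≡-Reasoning
  module M = UnitMove move
  u : Profile
  u = w′ [ q ]≔ w q
  u≡w : ∀ j → Within a l j → j ≢ p → u j ≡ w j
  u≡w j _ j≢p with j ≟ q
  ... | yes refl = refl
  ... | no j≢q = M.rest j j≢p j≢q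
  u-below-w : suc (∑ u a l) ≡ ∑ w a l
  u-below-w = +-cancelʳ-≡ (w′ p) _ _ (begin
    suc (∑ u a l) + w′ p ≡⟨ sym (+-suc (∑ u a l) (w′ p)) ⟩
    ∑ u a l + suc (w′ p) ≡⟨ cong (_+_ (∑ u a l)) (loses-suc 0<p M.loses) ⟩
    ∑ u a l + w p        ≡⟨ sym (∑-point a l u≡w p∈) ⟩
    ∑ w a l + u p        ≡⟨ cong (_+_ (∑ w a l)) ([]≔-other w′ _ p≢q) ⟩
    ∑ w a l + w′ p       ∎)
  u-below-w′ : suc (∑ u a l) ≡ ∑ w′ a l
  u-below-w′ = +-cancelʳ-≡ (w q) _ _ (begin
    suc (∑ u a l) + w q ≡⟨ sym (+-suc (∑ u a l) (w q)) ⟩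
    ∑ u a l + suc (w q) ≡⟨ cong (_+_ (∑ u a l)) (sym M.gains) ⟩
    ∑ u a l + w′ q      ≡⟨ ∑-point a l (λ j _ j≢q → sym ([]≔-other w′ _ j≢q)) q∈ ⟩
    ∑ w′ a l + u q      ≡⟨ cong (_+_ (∑ w′ a l)) ([]≔-same w′ q (w q)) ⟩
    ∑ w′ a l + w q      ∎)

az : ℕ → ℕ → ℕ
az n j = suc n ∸ j

az-suc : ∀ n {j} → j ≤ n → az n j ≡ suc (az n (suc j))
az-suc n j≤n = +-∸-assoc 1 j≤n

az-pos : ∀ n {j} → j ≤ n → 0 < az n j
az-pos n j≤n = m<n⇒0<n∸m (s≤s j≤n)

az-pos⇒≤ : ∀ n {j} → 0 < az n j → j ≤ n
az-pos⇒≤ n pos = ≤-pred (m∸n≢0⇒n<m (<⇒≢ pos ∘ sym))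

az≤n : ∀ n {j} → 0 < j → az n j ≤ n
az≤n n {suc j} _ = m∸n≤m n j

∑-az : ∀ n → 2 * ∑ (az n) 1 (suc n) ≡ n * suc n
∑-az zero = refl
∑-az (suc n) = begin
  2 * (suc n + ∑ (az (suc n)) 2 (suc n)) ≡⟨ cong (λ s → 2 * (suc n + s)) (∑-shift (az (suc n)) 1 (suc n)) ⟩
  2 * (suc n + ∑ (az n) 1 (suc n))       ≡⟨ *-distribˡ-+ 2 (suc n) _ ⟩
  2 * suc n + 2 * ∑ (az n) 1 (suc n)     ≡⟨ cong (_+_ (2 * suc n)) (∑-az n) ⟩
  2 * suc n + n * suc n                  ≡⟨ sym (*-distribʳ-+ (suc n) 2 n) ⟩
  (2 + n) * suc n                        ≡⟨ *-comm (2 + n) (suc n) ⟩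
  suc n * suc (suc n)                    ∎
  where open ≡-Reasoning

*≤∑-az : ∀ n r → r + r ≤ suc n → r * n ≤ ∑ (az n) 1 (suc n)
*≤∑-az n r 2r≤1+n = *-cancelˡ-≤ 2 (begin
  2 * (r * n)   ≡⟨ sym (*-assoc 2 r n) ⟩
  (r + (r + 0)) * n ≡⟨ cong (λ s → (r + s) * n) (+-identityʳ r) ⟩
  (r + r) * n   ≤⟨ *-monoˡ-≤ n 2r≤1+n ⟩
  suc n * n     ≡⟨ *-comm (suc n) n ⟩
  n * suc n     ≡⟨ sym (∑-az n) ⟩
  2 * ∑ (az n) 1 (suc n) ∎)
  where open ≤-Reasoning

r+r≤1+n⇒r≤n : ∀ {r n} → r + r ≤ suc n → r ≤ n
r+r≤1+n⇒r≤n {zero} _ = z≤n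
r+r≤1+n⇒r≤n {suc r} (s≤s 2r≤1+n) = ≤-trans (m≤n+m (suc r) r) 2r≤1+n

module PathFilling (n : ℕ) where

  Surplus : Profile → ℕ → Set
  Surplus w zero = ⊤
  Surplus w (suc p) = az n (suc p) < w (suc p)

  surplus-resp : ∀ p {w v} → v p ≡ w p → Surplus w p → Surplus v p
  surplus-resp zero _ _ = tt
  surplus-resp (suc p) vp≡wp s = subst (az n (suc p) <_) (sym vp≡wp) s

  pushable : ∀ p {w} → suc p ≤ n → w (suc p) < az n (suc p) → (0 < p → az n p ≤ w p) →
    Pushable n w p
  pushable zero _ short _ = short
  pushable (suc p) p<n short full =
    ≤-trans (s≤s short) (≤-trans (≤-reflexive (sym (az-suc n (<⇒≤ p<n)))) (full z<s))

  surplus-< : ∀ p {w} → 0 < p → Surplus w p → az n p < w p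
  surplus-< (suc p) _ s = s

  -- The unit travels by a relay: q-1 feeds q, which leaves q-1 exactly one short, and so on down to p.
  transport : ∀ p q {w w′} → p < q → q ≤ n →
    (∀ j → p < j → j < q → w j ≡ az n j) → w q < az n q → Surplus w p →
    UnitMove p q w w′ → Star (PathStep n) w w′
  transport p (suc q) {w} (s≤s p≤q) q<n flat short surplus move with m≤n⇒m<n∨m≡n p≤q
  ... | inj₂ refl = push p (pushable p q<n short (λ 0<p → <⇒≤ (surplus-< p 0<p surplus))) move ◅ ε
  ... | inj₁ p<q =
    push q (pushable q q<n short (λ _ → ≤-reflexive (sym wq≡az))) first ◅
    transport p q p<q (<⇒≤ q<n) flat₁ short₁ surplus₁ (unitMove-factor p<q first move)
    where
    wq≡az : w q ≡ az n q
    wq≡az = flat q p<q ≤-refl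
    relay : ∃ (UnitMove q (suc q) w)
    relay = unitMove q w (<⇒≢ (n<1+n q)) (λ _ → subst (0 <_) (sym wq≡az) (az-pos n (<⇒≤ q<n)))
    w₁ = proj₁ relay
    first = proj₂ relay
    module W₁ = UnitMove first
    flat₁ : ∀ j → p < j → j < q → w₁ j ≡ az n j
    flat₁ j p<j j<q =
      trans (W₁.rest j (<⇒≢ j<q) (<⇒≢ (m<n⇒m<1+n j<q))) (flat j p<j (m<n⇒m<1+n j<q))
    short₁ : w₁ q < az n q
    short₁ = ≤-reflexive (trans (loses-suc (≤-<-trans z≤n p<q) W₁.loses) wq≡az)
    surplus₁ : Surplus w₁ p
    surplus₁ = surplus-resp p (W₁.rest p (<⇒≢ p<q) (<⇒≢ (m<n⇒m<1+n p<q))) surplus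

  Budget : Profile → Set
  Budget w = ∑ w 1 (suc n) ≤ ∑ (az n) 1 (suc n)

  record Filling (q : ℕ) (w : Profile) : Set where
    field
      0<q    : 0 < q
      q≤1+n  : q ≤ suc n
      below  : ∀ j → 0 < j → j < q → az n j ≤ w j
      at     : w q ≤ az n q
      above  : ∀ j → q < j → w j ≡ 0
      budget : Budget w

  refill : ∀ {p q w w′} → Filling q w → p < q → Surplus w p → UnitMove p q w w′ →
    w q < az n q → Budget w′ → Filling q w′
  refill {p} {q} {w} {w′} F p<q surplus move short budget′ = record
    { 0<q    = 0<q
    ; q≤1+n  = q≤1+n
    ; below  = below′
    ; at     = subst (_≤ az n q) (sym M.gains) short
    ; above  = λ j q<j → trans (M.rest j (>⇒≢ (<-trans p<q q<j)) (>⇒≢ q<j)) (above j q<j)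
    ; budget = budget′ }
    where
    open Filling F
    module M = UnitMove move
    below′ : ∀ j → 0 < j → j < q → az n j ≤ w′ j
    below′ j 0<j j<q with j ≟ p
    ... | yes refl =
      ≤-pred (subst (az n j <_) (sym (loses-suc 0<j M.loses)) (surplus-< j 0<j surplus))
    ... | no j≢p = subst (az n j ≤_) (sym (M.rest j j≢p (<⇒≢ j<q))) (below j 0<j j<q)

  raiseFrom : ∀ p {q w} → Filling q w → w q < az n q → p < q → Surplus w p →
    (∀ j → p < j → j < q → w j ≡ az n j) → (∀ {w′} → UnitMove p q w w′ → Budget w′) →
    ∃[ w′ ] (Star (PathStep n) w w′ × Filling q w′ × w′ q ≡ suc (w q))
  raiseFrom p {q} {w} F short p<q surplus flat budget′ =
    w′ , transport p q p<q (az-pos⇒≤ n (≤-<-trans z≤n short)) flat short surplus move ,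
    refill F p<q surplus move short (budget′ move) , UnitMove.gains move
    where
    unit : ∃ (UnitMove p q w)
    unit = unitMove p w (<⇒≢ p<q) (λ 0<p → ≤-<-trans z≤n (surplus-< p 0<p surplus))
    w′ = proj₁ unit
    move = proj₂ unit

  under-az : ∀ {q w} → Filling q w → (∀ j → 0 < j → j < q → az n j ≡ w j) →
    ∀ j → Within 1 (suc n) j → w j ≤ az n j
  under-az {q} F flat j (0<j , _) with <-cmp j q
  ... | tri< j<q _ _ = ≤-reflexive (sym (flat j 0<j j<q))
  ... | tri≈ _ refl _ = Filling.at F
  ... | tri> _ _ q<j = subst (_≤ az n j) (sym (Filling.above F j q<j)) z≤n

  within-window : ∀ {j} → 0 < j → j ≤ suc n → Within 1 (suc n) j
  within-window 0<j j≤1+n = 0<j , s≤s j≤1+n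

  -- The unit comes from the highest cell with a surplus; failing one, from the marked face,
  -- and then the budget had room for it.
  raise : ∀ {q w} → Filling q w → w q < az n q →
    ∃[ w′ ] (Star (PathStep n) w w′ × Filling q w′ × w′ q ≡ suc (w q))
  raise {q} {w} F short with all-≡-or-last-< 0 q below
    where open Filling F
  ... | inj₁ none = raiseFrom 0 F short 0<q tt (λ j 0<j j<q → sym (none j 0<j j<q)) λ move →
    subst (_≤ ∑ (az n) 1 (suc n)) (sym (∑-unitMove-source 1 (suc n) z<s q∈ move))
      (∑-mono-< 1 (suc n) (under-az F none) q∈ short)
    where
    open Filling F
    q∈ = within-window 0<q q≤1+n
  ... | inj₂ (suc p , _ , p<q , excess , flat) =
    raiseFrom (suc p) F short p<q excess (λ j p<j j<q → sym (flat j p<j j<q)) λ move →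
    subst (_≤ ∑ (az n) 1 (suc n))
      (sym (∑-unitMove-inner 1 (suc n) z<s (<⇒≢ p<q) (within-window z<s (<⇒≤ (<-≤-trans p<q q≤1+n)))
        (within-window 0<q q≤1+n) move))
      budget
    where open Filling F

  fillCell : ∀ e {q w} → Filling q w → e + w q ≡ az n q →
    ∃[ w′ ] (Star (PathStep n) w w′ × Filling q w′ × w′ q ≡ az n q)
  fillCell zero F full = _ , ε , F , full
  fillCell (suc e) {q} {w} F gap with raise F (subst (suc (w q) ≤_) gap (s≤s (m≤n+m (w q) e)))
  ... | w₁ , steps₁ , F₁ , gained
    with fillCell e F₁ (trans (cong (_+_ e) gained) (trans (+-suc e (w q)) gap))
  ... | w₂ , steps₂ , F₂ , full = w₂ , steps₁ ◅◅ steps₂ , F₂ , full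

  advance : ∀ {q w} → Filling q w → w q ≡ az n q → q ≤ n → Filling (suc q) w
  advance {q} {w} F full q≤n = record
    { 0<q    = z<s
    ; q≤1+n  = s≤s q≤n
    ; below  = λ j 0<j j<1+q → extend-≤ j 0<j (m<1+n⇒m<n∨m≡n j<1+q)
    ; at     = subst (_≤ az n (suc q)) (sym (above (suc q) (n<1+n q))) z≤n
    ; above  = λ j 1+q<j → above j (<-trans (n<1+n q) 1+q<j)
    ; budget = budget }
    where
    open Filling F
    extend-≤ : ∀ j → 0 < j → j < q ⊎ j ≡ q → az n j ≤ w j
    extend-≤ j 0<j (inj₁ j<q) = below j 0<j j<q
    extend-≤ j 0<j (inj₂ refl) = ≤-reflexive (sym full)

  filled-window : ∀ {w} → Filling (suc n) w → ∀ j → Within 1 (suc n) j → az n j ≤ w j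
  filled-window {w} F j (0<j , s≤s j≤1+n) with m≤n⇒m<n∨m≡n j≤1+n
  ... | inj₁ j<1+n = Filling.below F j 0<j j<1+n
  ... | inj₂ refl = subst (_≤ w j) (sym (n∸n≡0 n)) z≤n

  -- Past the cell n + 1 both profiles vanish; inside, the budget forbids any surplus.
  finish : ∀ {w} → Filling (suc n) w → ∀ j → 0 < j → w j ≡ az n j
  finish {w} F j 0<j with j ≤? suc n
  ... | yes j≤1+n =
    ∑-≤-antisym 1 (suc n) (filled-window F) (Filling.budget F) j (within-window 0<j j≤1+n)
  ... | no j≰1+n = trans (Filling.above F j (≰⇒> j≰1+n)) (sym (m≤n⇒m∸n≡0 (<⇒≤ (≰⇒> j≰1+n))))

  fillFrom : ∀ d {q w} → d + q ≡ suc n → Filling q w →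
    ∃[ w′ ] (Star (PathStep n) w w′ × ∀ j → 0 < j → w′ j ≡ az n j)
  fillFrom zero refl F = _ , ε , finish F
  fillFrom (suc d) {q} {w} d+q F with fillCell (az n q ∸ w q) F (m∸n+n≡m (Filling.at F))
  ... | w₁ , steps₁ , F₁ , full
    with fillFrom d (trans (+-suc d q) d+q)
           (advance F₁ full (≤-pred (subst (q <_) d+q (s≤s (m≤n+m q d)))))
  ... | w₂ , steps₂ , done = w₂ , steps₁ ◅◅ steps₂ , done

  module _ {r k : ℕ} {w : Profile} (2r≤1+n : r + r ≤ suc n) (0<k : 0 < k) (k≤1+n : k ≤ suc n)
           (settled : ∀ j → 0 < j → j < k → w j ≡ az n j)
           (full : ∀ j → k ≤ j → j ≤ r → w j ≡ n)
           (empty : ∀ j → k ≤ j → r < j → w j ≡ 0) where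

    private
      r≤n : r ≤ n
      r≤n = r+r≤1+n⇒r≤n 2r≤1+n

      pulse-budget : k ≤ r → Budget w
      pulse-budget k≤r = begin
        ∑ w 1 (suc n)                       ≡⟨ cong (∑ w 1) (sym (m+[n∸m]≡n (≤-trans r≤n (n≤1+n n)))) ⟩
        ∑ w 1 (r + (suc n ∸ r))             ≡⟨ ∑-split w 1 r (suc n ∸ r) ⟩
        ∑ w 1 r + ∑ w (suc r) (suc n ∸ r)   ≤⟨ +-mono-≤ (∑-mono-≤ 1 r at-most-n) (∑-mono-≤ (suc r) (suc n ∸ r) vanishes) ⟩
        ∑ (λ _ → n) 1 r + ∑ (λ _ → 0) (suc r) (suc n ∸ r)
                                            ≡⟨ cong₂ _+_ (∑-const n 1 r) (∑-const 0 (suc r) (suc n ∸ r)) ⟩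
        r * n + (suc n ∸ r) * 0             ≡⟨ cong (_+_ (r * n)) (*-zeroʳ (suc n ∸ r)) ⟩
        r * n + 0                           ≡⟨ +-identityʳ (r * n) ⟩
        r * n                               ≤⟨ *≤∑-az n r 2r≤1+n ⟩
        ∑ (az n) 1 (suc n)                  ∎
        where
        open ≤-Reasoning
        at-most-n : ∀ j → Within 1 r j → w j ≤ n
        at-most-n j (0<j , j<1+r) with j <? k
        ... | yes j<k = ≤-trans (≤-reflexive (settled j 0<j j<k)) (az≤n n 0<j)
        ... | no j≮k = ≤-reflexive (full j (≮⇒≥ j≮k) (≤-pred j<1+r))
        vanishes : ∀ j → Within (suc r) (suc n ∸ r) j → w j ≤ 0
        vanishes j (r<j , _) = ≤-reflexive (empty j (≤-trans k≤r (<⇒≤ r<j)) r<j)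

      settled-or-full : ∀ j → 0 < j → j ≤ r → az n j ≤ w j
      settled-or-full j 0<j j≤r with j <? k
      ... | yes j<k = ≤-reflexive (sym (settled j 0<j j<k))
      ... | no j≮k = subst (az n j ≤_) (sym (full j (≮⇒≥ j≮k) j≤r)) (az≤n n 0<j)

      settled-or-empty : r < k → ∀ j → 0 < j → w j ≤ az n j
      settled-or-empty r<k j 0<j with j <? k
      ... | yes j<k = ≤-reflexive (settled j 0<j j<k)
      ... | no j≮k = subst (_≤ az n j) (sym (empty j (≮⇒≥ j≮k) (<-≤-trans r<k (≮⇒≥ j≮k)))) z≤n

      pulse-filling : k ≤ r → Filling (suc r) w
      pulse-filling k≤r = record
        { 0<q    = z<s
        ; q≤1+n  = s≤s r≤n
        ; below  = λ j 0<j j<1+r → settled-or-full j 0<j (≤-pred j<1+r)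
        ; at     = subst (_≤ az n (suc r)) (sym (empty (suc r) (≤-trans k≤r (n≤1+n r)) (n<1+n r))) z≤n
        ; above  = λ j 1+r<j → empty j (≤-trans k≤r (<⇒≤ (<-trans (n<1+n r) 1+r<j))) (<-trans (n<1+n r) 1+r<j)
        ; budget = pulse-budget k≤r }

      empty-filling : r < k → Filling k w
      empty-filling r<k = record
        { 0<q    = 0<k
        ; q≤1+n  = k≤1+n
        ; below  = λ j 0<j j<k → ≤-reflexive (sym (settled j 0<j j<k))
        ; at     = subst (_≤ az n k) (sym (empty k ≤-refl r<k)) z≤n
        ; above  = λ j k<j → empty j (<⇒≤ k<j) (<-trans r<k k<j)
        ; budget = ∑-mono-≤ 1 (suc n) λ j (0<j , _) → settled-or-empty r<k j 0<j }

    pulseTail : ∃[ w′ ] (Star (PathStep n) w w′ × ∀ j → 0 < j → w′ j ≡ az n j)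
    pulseTail with k ≤? r
    ... | yes k≤r = fillFrom (suc n ∸ suc r) (m∸n+n≡m (s≤s r≤n)) (pulse-filling k≤r)
    ... | no k≰r = fillFrom (suc n ∸ k) (m∸n+n≡m k≤1+n) (empty-filling (≰⇒> k≰r))

-- Shortest paths from f₀, and the rows of the quadrants

≡+⇒≡+∣∣ : ∀ {i m} → i ≡ + m → i ≡ + ∣ i ∣
≡+⇒≡+∣∣ refl = refl

module GeodesicRay (π : ℕ → Face) (π-zero : π 0 ≡ f₀)
                   (π-dist : ∀ j → dist f₀ (π j) ≡ j)
                   (π-adj : ∀ j → Adjacent (π j) (π (suc j))) where

  π≢f₀ : ∀ j → π (suc j) ≢ f₀
  π≢f₀ j π≡f₀ =
    0≢1+n (trans (sym (dist-self f₀)) (trans (cong (dist f₀) (sym π≡f₀)) (π-dist (suc j))))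

  on-ray? : ∀ h → (∃[ j ] h ≡ π (suc j)) ⊎ (∀ j → h ≢ π (suc j))
  on-ray? h = decide (dist f₀ h) refl
    where
    depth : ∀ {j} → h ≡ π j → dist f₀ h ≡ j
    depth {j} h≡πj = trans (cong (dist f₀) h≡πj) (π-dist j)
    decide : ∀ i → dist f₀ h ≡ i → (∃[ j ] h ≡ π (suc j)) ⊎ (∀ j → h ≢ π (suc j))
    decide zero d = inj₂ λ j h≡π → 0≢1+n (trans (sym d) (depth h≡π))
    decide (suc i) d with h ≟F π (suc i)
    ... | yes h≡π = inj₁ (i , h≡π)
    ... | no h≢π = inj₂ λ j h≡π → h≢π (trans h≡π (cong π (trans (sym (depth h≡π)) d)))

  along : Config → Profile → Config
  along K w h = read (dist f₀ h) (h ≟F π (dist f₀ h))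
    where
    read : (j : ℕ) → Dec (h ≡ π j) → ℤ
    read zero _ = K h
    read (suc j) (yes _) = + w (suc j)
    read (suc j) (no _) = K h

  along-on : ∀ K w j → along K w (π (suc j)) ≡ + w (suc j)
  along-on K w j with dist f₀ (π (suc j)) | π-dist (suc j) | π (suc j) ≟F π (dist f₀ (π (suc j)))
  ... | .(suc j) | refl | yes _ = refl
  ... | .(suc j) | refl | no π≢π = ⊥-elim (π≢π refl)

  along-off : ∀ K w {h} → (∀ j → h ≢ π (suc j)) → along K w h ≡ K h
  along-off K w {h} off with dist f₀ h | h ≟F π (dist f₀ h)
  ... | zero | _ = refl
  ... | suc j | yes h≡π = ⊥-elim (off j h≡π)
  ... | suc j | no _ = refl

  along-cong-at : ∀ K {w w′} h → (∀ j → h ≡ π (suc j) → w′ (suc j) ≡ w (suc j)) →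
    along K w′ h ≡ along K w h
  along-cong-at K {w} {w′} h agree with on-ray? h
  ... | inj₁ (j , refl) = trans (along-on K w′ j) (trans (cong +_ (agree j refl)) (sym (along-on K w j)))
  ... | inj₂ off = trans (along-off K w′ off) (sym (along-off K w off))

  along-self : ∀ K → (∀ j → K (π (suc j)) ≡ + ∣ K (π (suc j)) ∣) →
    along K (λ j → ∣ K (π j) ∣) ≗ K
  along-self K nonneg h with on-ray? h
  ... | inj₁ (j , refl) = trans (along-on K _ j) (sym (nonneg j))
  ... | inj₂ off = along-off K _ off

  along-+1 : ∀ K {w w′} j → w′ (suc j) ≡ suc (w (suc j)) →
    along K w′ (π (suc j)) ≡ along K w (π (suc j)) ℤ.+ + 1
  along-+1 K {w} {w′} j gain = begin
    along K w′ (π (suc j))        ≡⟨ along-on K w′ j ⟩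
    + w′ (suc j)                  ≡⟨ cong +_ (trans gain (+-comm 1 (w (suc j)))) ⟩
    + w (suc j) ℤ.+ + 1           ≡⟨ cong (ℤ._+ + 1) (sym (along-on K w j)) ⟩
    along K w (π (suc j)) ℤ.+ + 1 ∎
    where open ≡-Reasoning

  along-−1 : ∀ K {w w′} j → suc (w′ (suc j)) ≡ w (suc j) →
    along K w′ (π (suc j)) ≡ along K w (π (suc j)) ℤ.- + 1
  along-−1 K {w} {w′} j loss = begin
    along K w′ (π (suc j))        ≡⟨ along-on K w′ j ⟩
    + w′ (suc j)                  ≡⟨ sym (ℤₚ.[1+m]⊖[1+n]≡m⊖n (w′ (suc j)) 0) ⟩
    + suc (w′ (suc j)) ℤ.- + 1    ≡⟨ cong (λ m → + m ℤ.- + 1) loss ⟩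
    + w (suc j) ℤ.- + 1           ≡⟨ cong (ℤ._- + 1) (sym (along-on K w j)) ⟩
    along K w (π (suc j)) ℤ.- + 1 ∎
    where open ≡-Reasoning

  off-index : ∀ {h i j} → h ≢ π i → h ≡ π j → j ≢ i
  off-index h≢πi h≡πj j≡i = h≢πi (trans h≡πj (cong π j≡i))

  along-step : ∀ {n} K {w w′} → PathStep n w w′ → Step n (along K w) (along K w′)
  along-step {n} K {w} {w′} (push zero w1<n move) =
    fromMarked (π 1) π1~f₀ (subst (ℤ._< + n) (sym (along-on K w 0)) (+<+ w1<n)) (along-+1 K 0 M.gains)
      λ h h≢π1 → along-cong-at K h λ j h≡π → M.rest (suc j) (λ ()) (off-index h≢π1 h≡π)
    where
    module M = UnitMove move
    π1~f₀ : Adjacent (π 1) f₀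
    π1~f₀ = trans (dist-comm (π 1) f₀) (subst (λ f → dist f (π 1) ≡ 1) π-zero (π-adj 0))
  along-step {n} K {w} {w′} (push (suc p) pushable move) =
    fire (π (suc p)) (π (suc (suc p))) (π≢f₀ p) (π≢f₀ (suc p)) (π-adj (suc p)) steep
      (along-−1 K p M.loses) (along-+1 K (suc p) M.gains)
      λ h h≢πp h≢πq → along-cong-at K h λ j h≡π →
        M.rest (suc j) (off-index h≢πp h≡π) (off-index h≢πq h≡π)
    where
    module M = UnitMove move
    steep : along K w (π (suc (suc p))) ℤ.+ + 2 ℤ.≤ along K w (π (suc p))
    steep = subst₂ ℤ._≤_ (cong (ℤ._+ + 2) (sym (along-on K w (suc p)))) (sym (along-on K w p))
      (+≤+ (subst (_≤ w (suc p)) (+-comm 2 _) pushable))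

  along-reaches : ∀ {n} K {w w′} → Star (PathStep n) w w′ → Reaches n (along K w) (along K w′)
  along-reaches K = gmap (along K) (along-step K)

  Az-on-ray : ∀ n j → Az n (π (suc j)) ≡ + az n (suc j)
  Az-on-ray n j = trans (Az-≢f₀ n (π≢f₀ j)) (cong (λ d → + (suc n ∸ d)) (π-dist (suc j)))

  fillRay : ∀ {n r} k K → r + r ≤ suc n → 0 < k → k ≤ suc n →
    (∀ j → 0 < j → j < k → K (π j) ≡ Az n (π j)) →
    (∀ j → k ≤ j → K (π j) ≡ pulse n r (π j)) →
    ∃[ K′ ] (Reaches n K K′ × K′ ≗ along K (az n))
  fillRay {n} {r} k K 2r≤1+n 0<k k≤1+n settled tail
    with PathFilling.pulseTail n 2r≤1+n 0<k k≤1+n settled′ full empty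
    where
    settled′ : ∀ j → 0 < j → j < k → ∣ K (π j) ∣ ≡ az n j
    settled′ (suc j) _ j<k = cong ∣_∣ (trans (settled (suc j) z<s j<k) (Az-on-ray n j))
    full : ∀ j → k ≤ j → j ≤ r → ∣ K (π j) ∣ ≡ n
    full j k≤j j≤r = cong ∣_∣ (trans (tail j k≤j) (pulse-≤ n r (subst (_≤ r) (sym (π-dist j)) j≤r)))
    empty : ∀ j → k ≤ j → r < j → ∣ K (π j) ∣ ≡ 0
    empty j k≤j r<j = cong ∣_∣ (trans (tail j k≤j) (pulse-> n r (subst (r <_) (sym (π-dist j)) r<j)))
  ... | u , steps , done with Reaches-respˡ (λ h → sym (along-self K nonneg h)) (along-reaches K steps)
    where
    nonneg : ∀ j → K (π (suc j)) ≡ + ∣ K (π (suc j)) ∣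
    nonneg j with suc j <? k
    ... | yes j<k = ≡+⇒≡+∣∣ (trans (settled (suc j) z<s j<k) (Az-on-ray n j))
    ... | no j≮k = ≡+⇒≡+∣∣ (trans (tail (suc j) (≮⇒≥ j≮k)) (pulse-nonneg n r (π (suc j))))
  ... | K′ , reaches , K′≗ =
    K′ , reaches , λ h → trans (K′≗ h) (along-cong-at K h λ j _ → done (suc j) z<s)

∣m⊖1+m∣≡1 : ∀ m → ∣ m ⊖ suc m ∣ ≡ 1
∣m⊖1+m∣≡1 zero = refl
∣m⊖1+m∣≡1 (suc m) = trans (cong ∣_∣ (ℤₚ.[1+m]⊖[1+n]≡m⊖n m (suc m))) (∣m⊖1+m∣≡1 m)

adjacent-x : ∀ x x′ y → ∣ x ℤ.- x′ ∣ ≡ 1 → Adjacent (x , y) (x′ , y)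
adjacent-x x x′ y ∣x-x′∣≡1 = cong₂ _+_ ∣x-x′∣≡1 (∣i-i∣≡0 y)

adjacent-y : ∀ x y y′ → ∣ y ℤ.- y′ ∣ ≡ 1 → Adjacent (x , y) (x , y′)
adjacent-y x y y′ ∣y-y′∣≡1 = cong₂ _+_ (∣i-i∣≡0 x) ∣y-y′∣≡1

+m~+[1+m] : ∀ m → ∣ + m ℤ.- + suc m ∣ ≡ 1
+m~+[1+m] = ∣m⊖1+m∣≡1

-[1+m]~-[2+m] : ∀ m → ∣ -[1+ m ] ℤ.- -[1+ suc m ] ∣ ≡ 1
-[1+m]~-[2+m] m = trans (ℤₚ.∣m⊖n∣≡∣n⊖m∣ (suc (suc m)) (suc m)) (+m~+[1+m] (suc m))

data Quadrant : Set where
  q0 q1 q2 q3 : Quadrant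

next : Quadrant → Quadrant
next q0 = q1
next q1 = q2
next q2 = q3
next q3 = q0

index : Quadrant → ℕ
index q0 = 0
index q1 = 1
index q2 = 2
index q3 = 3

fromIndex : ℕ → Quadrant
fromIndex 0 = q0
fromIndex 1 = q1
fromIndex 2 = q2
fromIndex _ = q3

fromIndex-index : ∀ c → fromIndex (index c) ≡ c
fromIndex-index q0 = refl
fromIndex-index q1 = refl
fromIndex-index q2 = refl
fromIndex-index q3 = refl

index-injective : ∀ {c d} → index c ≡ index d → c ≡ d
index-injective {c} {d} eq = trans (sym (fromIndex-index c)) (trans (cong fromIndex eq) (fromIndex-index d))

index<4 : ∀ c → index c < 4
index<4 q0 = s≤s z≤n
index<4 q1 = s≤s (s≤s z≤n)
index<4 q2 = s≤s (s≤s (s≤s z≤n))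
index<4 q3 = s≤s (s≤s (s≤s (s≤s z≤n)))

-- cell c a b is the face (a + 1 , b) turned index c quarter-turns about f₀.
cell : Quadrant → ℕ → ℕ → Face
cell q0 a b = (+ suc a , + b)
cell q1 a zero = (+ 0 , + suc a)
cell q1 a (suc b) = (-[1+ b ] , + suc a)
cell q2 a zero = (-[1+ a ] , + 0)
cell q2 a (suc b) = (-[1+ a ] , -[1+ b ])
cell q3 a b = (+ b , -[1+ a ])

quadrant : Face → Quadrant
quadrant (+ zero , + zero) = q0
quadrant (+ suc a , + b) = q0
quadrant (+ zero , + suc a) = q1
quadrant (-[1+ b ] , + suc a) = q1
quadrant (-[1+ a ] , + zero) = q2
quadrant (-[1+ a ] , -[1+ b ]) = q2
quadrant (+ b , -[1+ a ]) = q3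

column : Face → ℕ
column (+ zero , + zero) = 0
column (+ suc a , + b) = a
column (+ zero , + suc a) = a
column (-[1+ b ] , + suc a) = a
column (-[1+ a ] , + zero) = a
column (-[1+ a ] , -[1+ b ]) = a
column (+ b , -[1+ a ]) = a

row : Face → ℕ
row (+ zero , + zero) = 0
row (+ suc a , + b) = b
row (+ zero , + suc a) = 0
row (-[1+ b ] , + suc a) = suc b
row (-[1+ a ] , + zero) = 0
row (-[1+ a ] , -[1+ b ]) = suc b
row (+ b , -[1+ a ]) = b

cell-coordinates : ∀ h → h ≢ f₀ → cell (quadrant h) (column h) (row h) ≡ h
cell-coordinates (+ zero , + zero) h≢f₀ = ⊥-elim (h≢f₀ refl)
cell-coordinates (+ suc a , + b) _ = refl
cell-coordinates (+ zero , + suc a) _ = refl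
cell-coordinates (-[1+ b ] , + suc a) _ = refl
cell-coordinates (-[1+ a ] , + zero) _ = refl
cell-coordinates (-[1+ a ] , -[1+ b ]) _ = refl
cell-coordinates (+ zero , -[1+ a ]) _ = refl
cell-coordinates (+ suc b , -[1+ a ]) _ = refl

quadrant-cell : ∀ c a b → quadrant (cell c a b) ≡ c
quadrant-cell q0 a b = refl
quadrant-cell q1 a zero = refl
quadrant-cell q1 a (suc b) = refl
quadrant-cell q2 a zero = refl
quadrant-cell q2 a (suc b) = refl
quadrant-cell q3 a zero = refl
quadrant-cell q3 a (suc b) = refl

row-cell : ∀ c a b → row (cell c a b) ≡ b
row-cell q0 a b = refl
row-cell q1 a zero = refl
row-cell q1 a (suc b) = refl
row-cell q2 a zero = refl
row-cell q2 a (suc b) = refl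
row-cell q3 a zero = refl
row-cell q3 a (suc b) = refl

dist-cell : ∀ c a b → dist f₀ (cell c a b) ≡ suc (a + b)
dist-cell q0 a zero = refl
dist-cell q0 a (suc b) = refl
dist-cell q1 a zero = cong suc (sym (+-identityʳ a))
dist-cell q1 a (suc b) = +-comm (suc b) (suc a)
dist-cell q2 a zero = refl
dist-cell q2 a (suc b) = refl
dist-cell q3 a zero = cong suc (sym (+-identityʳ a))
dist-cell q3 a (suc b) = +-comm (suc b) (suc a)

cell-adj : ∀ c a b → Adjacent (cell c a b) (cell c (suc a) b)
cell-adj q0 a b = adjacent-x (+ suc a) (+ suc (suc a)) (+ b) (+m~+[1+m] (suc a))
cell-adj q1 a zero = adjacent-y (+ 0) (+ suc a) (+ suc (suc a)) (+m~+[1+m] (suc a))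
cell-adj q1 a (suc b) = adjacent-y -[1+ b ] (+ suc a) (+ suc (suc a)) (+m~+[1+m] (suc a))
cell-adj q2 a zero = adjacent-x -[1+ a ] -[1+ suc a ] (+ 0) (-[1+m]~-[2+m] a)
cell-adj q2 a (suc b) = adjacent-x -[1+ a ] -[1+ suc a ] -[1+ b ] (-[1+m]~-[2+m] a)
cell-adj q3 a b = adjacent-y (+ b) -[1+ a ] -[1+ suc a ] (-[1+m]~-[2+m] a)

corner-adj : ∀ c b → Adjacent (cell (next c) b 0) (cell c 0 (suc b))
corner-adj q0 b = adjacent-x (+ 0) (+ 1) (+ suc b) refl
corner-adj q1 b = adjacent-y -[1+ b ] (+ 0) (+ 1) refl
corner-adj q2 b = adjacent-x (+ 0) -[1+ 0 ] -[1+ b ] refl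
corner-adj q3 b = adjacent-y (+ suc b) (+ 0) -[1+ 0 ] refl

f₀-adj : ∀ c → Adjacent f₀ (cell c 0 0)
f₀-adj q0 = refl
f₀-adj q1 = refl
f₀-adj q2 = refl
f₀-adj q3 = refl

-- The ray to row b of quadrant c runs along row 0 of the next quadrant for b steps, then turns into row b.
rowRay : Quadrant → ℕ → ℕ → Face
rowRay c b zero = f₀
rowRay c b (suc j) with j <? b
... | yes _ = cell (next c) j 0
... | no _ = cell c (j ∸ b) b

rowRay-dist : ∀ c b j → dist f₀ (rowRay c b j) ≡ j
rowRay-dist c b zero = refl
rowRay-dist c b (suc j) with j <? b
... | yes _ = trans (dist-cell (next c) j 0) (cong suc (+-identityʳ j))
... | no j≮b = trans (dist-cell c (j ∸ b) b) (cong suc (m∸n+n≡m (≮⇒≥ j≮b)))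

rowRay-adj : ∀ c b j → Adjacent (rowRay c b j) (rowRay c b (suc j))
rowRay-adj c zero zero = f₀-adj c
rowRay-adj c (suc b) zero = f₀-adj (next c)
rowRay-adj c b (suc j) with j <? b | suc j <? b
... | yes _ | yes _ = cell-adj (next c) j 0
... | no j≮b | yes 1+j<b = ⊥-elim (j≮b (<-trans (n<1+n j) 1+j<b))
... | no j≮b | no _ rewrite +-∸-assoc 1 (≮⇒≥ j≮b) = cell-adj c (j ∸ b) b
... | yes j<b | no 1+j≮b with ≤-antisym j<b (≮⇒≥ 1+j≮b)
...   | refl = subst (λ a → Adjacent (cell (next c) j 0) (cell c a (suc j))) (sym (n∸n≡0 j)) (corner-adj c j)

rowRay-tail : ∀ c b j → b < j → quadrant (rowRay c b j) ≡ c × row (rowRay c b j) ≡ b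
rowRay-tail c b (suc j) (s≤s b≤j) with j <? b
... | yes j<b = ⊥-elim (<⇒≱ j<b b≤j)
... | no _ = quadrant-cell c (j ∸ b) b , row-cell c (j ∸ b) b

rowRay-prefix : ∀ c b j → 0 < j → j ≤ b → row (rowRay c b j) < b
rowRay-prefix c b (suc j) _ j<b with j <? b
... | yes _ = subst (_< b) (sym (row-cell (next c) j 0)) (≤-<-trans z≤n j<b)
... | no j≮b = ⊥-elim (j≮b j<b)

rowRay-cell : ∀ c b a → rowRay c b (suc (b + a)) ≡ cell c a b
rowRay-cell c b a with (b + a) <? b
... | yes b+a<b = ⊥-elim (<⇒≱ b+a<b (m≤m+n b a))
... | no _ = cong (λ a′ → cell c a′ b) (m+n∸m≡n b a)

-- Sweeping the plane

dist-coordinates : ∀ h → h ≢ f₀ → dist f₀ h ≡ suc (column h + row h)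
dist-coordinates h h≢f₀ =
  trans (cong (dist f₀) (sym (cell-coordinates h h≢f₀))) (dist-cell (quadrant h) (column h) (row h))

Swept : ℕ → ℕ → Face → Set
Swept b i h = row h < b ⊎ (row h ≡ b × index (quadrant h) < i)

rowRay-swept : ∀ c b j → Swept b (suc (index c)) (rowRay c b (suc j))
rowRay-swept c b j with b ≤? j
... | no b≰j = inj₁ (rowRay-prefix c b (suc j) z<s (≰⇒> b≰j))
... | yes b≤j with rowRay-tail c b (suc j) (s≤s b≤j)
...   | quadrant≡c , row≡b =
  inj₂ (row≡b , subst (λ d → index d < suc (index c)) (sym quadrant≡c) (n<1+n (index c)))

off-rowRay-swept : ∀ c b {h} → h ≢ f₀ → (∀ j → h ≢ rowRay c b (suc j)) →
  Swept b (suc (index c)) h → Swept b (index c) h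
off-rowRay-swept c b _ _ (inj₁ row<b) = inj₁ row<b
off-rowRay-swept c b {h} h≢f₀ off (inj₂ (refl , q<1+c)) with m<1+n⇒m<n∨m≡n q<1+c
... | inj₁ q<c = inj₂ (refl , q<c)
... | inj₂ q≡c = ⊥-elim (off (row h + column h) (sym (begin
  rowRay c (row h) (suc (row h + column h)) ≡⟨ rowRay-cell c (row h) (column h) ⟩
  cell c (column h) (row h)                 ≡⟨ cong (λ d → cell d (column h) (row h)) (sym (index-injective q≡c)) ⟩
  cell (quadrant h) (column h) (row h)      ≡⟨ cell-coordinates h h≢f₀ ⟩
  h                                         ∎)))
  where open ≡-Reasoning

module Sweep (n r : ℕ) (2r≤1+n : r + r ≤ suc n) where

  record Stage (b i : ℕ) (K : Config) : Set where
    field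
      marked  : K f₀ ≡ + n
      swept   : ∀ h → h ≢ f₀ → Swept b i h → K h ≡ Az n h
      unswept : ∀ h → h ≢ f₀ → ¬ Swept b i h → K h ≡ pulse n r h

  stage-resp : ∀ {b i K K′} → K′ ≗ K → Stage b i K → Stage b i K′
  stage-resp K′≗K S = record
    { marked  = trans (K′≗K f₀) marked
    ; swept   = λ h h≢f₀ s → trans (K′≗K h) (swept h h≢f₀ s)
    ; unswept = λ h h≢f₀ ns → trans (K′≗K h) (unswept h h≢f₀ ns) }
    where open Stage S

  Reachable : ℕ → ℕ → Set
  Reachable b i = ∃[ K ] (Reaches n (pulse n r) K × Stage b i K)

  module _ (c : Quadrant) (b : ℕ) where
    open GeodesicRay (rowRay c b) refl (rowRay-dist c b) (rowRay-adj c b)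

    stage-along : ∀ {K} → Stage b (index c) K → Stage b (suc (index c)) (along K (az n))
    stage-along {K} S = record
      { marked  = trans (along-off K (az n) λ j f₀≡π → π≢f₀ j (sym f₀≡π)) marked
      ; swept   = swept′
      ; unswept = unswept′ }
      where
      open Stage S
      swept′ : ∀ h → h ≢ f₀ → Swept b (suc (index c)) h → along K (az n) h ≡ Az n h
      swept′ h h≢f₀ s with on-ray? h
      ... | inj₁ (j , refl) = trans (along-on K (az n) j) (sym (Az-on-ray n j))
      ... | inj₂ off = trans (along-off K _ off) (swept h h≢f₀ (off-rowRay-swept c b h≢f₀ off s))
      unswept′ : ∀ h → h ≢ f₀ → ¬ Swept b (suc (index c)) h → along K (az n) h ≡ pulse n r h
      unswept′ h h≢f₀ ns with on-ray? h
      ... | inj₁ (j , refl) = ⊥-elim (ns (rowRay-swept c b j))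
      ... | inj₂ off = trans (along-off K _ off) (unswept h h≢f₀ λ s → ns (widen s))
        where
        widen : Swept b (index c) h → Swept b (suc (index c)) h
        widen (inj₁ row<b) = inj₁ row<b
        widen (inj₂ (row≡b , q<c)) = inj₂ (row≡b , m<n⇒m<1+n q<c)

    sweepRay : b < n → Reachable b (index c) → Reachable b (suc (index c))
    sweepRay b<n (K , reaches , S)
      with fillRay (suc b) K 2r≤1+n z<s (s≤s (<⇒≤ b<n)) settled tail
      where
      open Stage S
      settled : ∀ j → 0 < j → j < suc b → K (rowRay c b j) ≡ Az n (rowRay c b j)
      settled (suc j) _ (s≤s j<b) = swept _ (π≢f₀ j)
        (inj₁ (rowRay-prefix c b (suc j) z<s j<b))
      tail≢f₀ : ∀ j → suc b ≤ j → rowRay c b j ≢ f₀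
      tail≢f₀ (suc j) _ = π≢f₀ j
      tail : ∀ j → suc b ≤ j → K (rowRay c b j) ≡ pulse n r (rowRay c b j)
      tail j b<j with rowRay-tail c b j b<j
      ... | quadrant≡c , row≡b = unswept _ (tail≢f₀ j b<j) λ
        { (inj₁ row<b) → <-irrefl row≡b row<b
        ; (inj₂ (_ , q<c)) → <-irrefl (cong index quadrant≡c) q<c }
    ... | K′ , reaches′ , K′≗ = K′ , reaches ◅◅ reaches′ , stage-resp K′≗ (stage-along S)

  nextRow : ∀ {b K} → Stage b 4 K → Stage (suc b) 0 K
  nextRow {b} S = record
    { marked  = marked
    ; swept   = λ h h≢f₀ s → swept h h≢f₀ (narrow s)
    ; unswept = λ h h≢f₀ ns → unswept h h≢f₀ (ns ∘ widen) }
    where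
    open Stage S
    narrow : ∀ {h} → Swept (suc b) 0 h → Swept b 4 h
    narrow {h} (inj₁ row<1+b) with m<1+n⇒m<n∨m≡n row<1+b
    ... | inj₁ row<b = inj₁ row<b
    ... | inj₂ row≡b = inj₂ (row≡b , index<4 (quadrant h))
    widen : ∀ {h} → Swept b 4 h → Swept (suc b) 0 h
    widen (inj₁ row<b) = inj₁ (m<n⇒m<1+n row<b)
    widen (inj₂ (refl , _)) = inj₁ (n<1+n b)

  sweepRow : ∀ {b} → b < n → Reachable b 0 → Reachable (suc b) 0
  sweepRow {b} b<n =
    map₂ (map₂ nextRow) ∘ sweepRay q3 b b<n ∘ sweepRay q2 b b<n ∘ sweepRay q1 b b<n ∘ sweepRay q0 b b<n

  start : Reachable 0 0
  start = pulse n r , ε , record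
    { marked  = pulse-≤ n r {f₀} z≤n
    ; swept   = λ { _ _ (inj₁ ()) ; _ _ (inj₂ (_ , ())) }
    ; unswept = λ _ _ _ → refl }

  sweepRows : ∀ b → b ≤ n → Reachable b 0
  sweepRows zero _ = start
  sweepRows (suc b) b<n = sweepRow b<n (sweepRows b (<⇒≤ b<n))

  -- Faces in row n or beyond lie outside both the pulse and the diamond.
  stage-final : ∀ {K} → Stage n 0 K → K ≗ Az n
  stage-final {K} S h = split (h ≟F f₀)
    where
    open Stage S
    split : Dec (h ≡ f₀) → K h ≡ Az n h
    split (yes refl) = trans marked (sym (Az-f₀ n))
    split (no h≢f₀) with row h <? n
    ... | yes row<n = swept h h≢f₀ (inj₁ row<n)
    ... | no row≮n = begin
      K h                   ≡⟨ unswept h h≢f₀ (λ { (inj₁ row<n) → row≮n row<n ; (inj₂ (_ , ())) }) ⟩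
      pulse n r h           ≡⟨ pulse-> n r (<-≤-trans (s≤s (r+r≤1+n⇒r≤n 2r≤1+n)) far) ⟩
      + 0                   ≡⟨ cong +_ (sym (m≤n⇒m∸n≡0 far)) ⟩
      + (suc n ∸ dist f₀ h) ≡⟨ sym (Az-≢f₀ n h≢f₀) ⟩
      Az n h                ∎
      where
      open ≡-Reasoning
      far : suc n ≤ dist f₀ h
      far = subst (suc n ≤_) (sym (dist-coordinates h h≢f₀))
        (s≤s (≤-trans (≮⇒≥ row≮n) (m≤n+m (row h) (column h))))

  pulse-reaches-Az : ∃[ K ] (Reaches n (pulse n r) K × K ≗ Az n)
  pulse-reaches-Az with sweepRows n ≤-refl
  ... | K , reaches , S = K , reaches , stage-final S

m≤⌊n/2⌋⇒m+m≤n : ∀ m n → m ≤ ⌊ n /2⌋ → m + m ≤ n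
m≤⌊n/2⌋⇒m+m≤n m n m≤⌊n/2⌋ = begin
  m + m               ≤⟨ +-mono-≤ m≤⌊n/2⌋ (≤-trans m≤⌊n/2⌋ (⌊n/2⌋≤⌈n/2⌉ n)) ⟩
  ⌊ n /2⌋ + ⌈ n /2⌉   ≡⟨ ⌊n/2⌋+⌈n/2⌉≡n n ⟩
  n                   ∎
  where open ≤-Reasoning

theorem5p10 : (n r : ℕ) → 2 ≤ r → r ≤ ⌈ n /2⌉ →
    Stable n (Az n) × (∃[ K ] (Reaches n (pulse n r) K × (∀ f → K f ≡ Az n f)))
theorem5p10 n r _ r≤⌈n/2⌉ =
  Az-stable n , Sweep.pulse-reaches-Az n r (m≤⌊n/2⌋⇒m+m≤n r (suc n) r≤⌈n/2⌉)
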